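{- Let $c_0=0$ and $c_\ell=\beta^{\ell-1}+\beta\cdot(\lceil n_{\ell-1}/2\rceil+1)\cdot c_{\ell-1}$ for $\ell>0$. The expected optimal offline cost (the adversary's cost) of serving the requests generated by one run of $\mathsf{adversary}(k)$, with $k$ servers of weights $1,\beta,\dots,\beta^{k-1}$ starting from any initial configuration, is at most $\beta^{k-1}+\big((n_{k-1}+1)\cdot H(n_{k-1}+1)-1\big)\cdot c_{k-1}$.
   Context: Weighted $k$-server on a uniform metric space (all distinct points at distance 1): $k$ servers with weights $1,\beta,\beta^2,\dots,\beta^{k-1}$ ($\beta$ a large positive integer); each request is a point which must then be occupied by some server; moving the server of weight $w$ to a different point costs $w$. $H(n)=\sum_{i=1}^n1/i$. The sequence $n_0,n_1,\dots$ is defined by $n_0=1$ and $n_i=(\lceil n_{i-1}/2\rceil+1)(\lfloor n_{i-1}/2\rfloor+1)$. For every $\ell>0$ and every set $Y$ of $n_\ell$ points, fix a set system $\mathcal{Q}(Y)\subseteq 2^Y$ such that: (1) $\mathcal{Q}(Y)$ consists of $\lceil n_{\ell-1}/2\rceil+1$ sets, each of size $n_{\ell-1}$; (2) for every $p\in Y$ some set in $\mathcal{Q}(Y)$ does not contain $p$; (3) for every $p\in Y$ there is $q\in Y$ such that every set in $\mathcal{Q}(Y)$ contains $p$ or $q$. Procedure $\mathsf{strategy}(\ell,Y)$, for $|Y|=n_\ell$: if $\ell=0$, issue one request at the unique point of $Y$; if $\ell>0$, repeat $\beta\cdot(\lceil n_{\ell-1}/2\rceil+1)$ times: pick $Y'$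 uniformly at random from $\mathcal{Q}(Y)$ independently of all previous choices and call $\mathsf{strategy}(\ell-1,Y')$. Procedure $\mathsf{adversary}(k)$: take the uniform metric space on a set $P$ of $n_{k-1}+1$ points, all initially unmarked; repeat: pick $p$ uniformly at random from $P$ (independently) and mark it; if not all points are marked, call $\mathsf{strategy}(k-1,P\setminus\{p\})$; otherwise stop. The offline adversary knows the entire generated request sequence in advance. -}

module Defs where

open import Data.Bool using (Bool; true; false; if_then_else_; _∧_; _∨_)
open import Data.Nat using (ℕ; zero; suc; _+_; _*_; _^_; _⊓_; ⌈_/2⌉; ⌊_/2⌋)
open import Data.Fin using (Fin)
open import Data.Fin.Properties using (_≟_)
open import Data.Fin.Subset using (Subset; _∪_; ⁅_⁆; ∁)
open import Data.List using (List; []; _∷_; _++_; map; concatMap; foldr; length; filterᵇ; allFin)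
open import Data.Vec using (Vec; []; _∷_; lookup; tail)
open import Data.Integer using (+_)
open import Data.Rational using (ℚ; _/_; 0ℚ; 1ℚ)
open import Data.Product using (_×_; _,_)
open import Relation.Nullary.Decidable using (⌊_⌋)

nseq : ℕ → ℕ
nseq zero    = 1
nseq (suc l) = (⌈ nseq l /2⌉ + 1) * (⌊ nseq l /2⌋ + 1)

cseq : (β : ℕ) → ℕ → ℕ
cseq β zero    = 0
cseq β (suc l) = β ^ l + β * (⌈ nseq l /2⌉ + 1) * cseq β l

H : ℕ → ℚ
H zero    = 0ℚ
H (suc n) = H n Data.Rational.+ (+ 1 / suc n)

fromℕ : ℕ → ℚ
fromℕ n = + n / 1

Dist : Set → Set
Dist A = List (ℚ × A)

return : {A : Set} → A → Dist A
return a = (1ℚ , a) ∷ []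

_>>=_ : {A B : Set} → Dist A → (A → Dist B) → Dist B
d >>= f = concatMap (λ { (p , a) → map (λ { (q , b) → (p Data.Rational.* q , b) }) (f a) }) d

uniform : {A : Set} → List A → Dist A
uniform []       = []
uniform (x ∷ xs) = map (λ y → (+ 1 / suc (length xs) , y)) (x ∷ xs)

members : {m : ℕ} → Subset m → List (Fin m)
members {m} Y = filterᵇ (lookup Y) (allFin m)

-- A choice of set systems: Q ℓ Y is the (list of sets of) 𝒬(Y) for |Y| = n_ℓ
SetSystem : ℕ → Set
SetSystem m = ℕ → Subset m → List (Subset m)

strategy : {m : ℕ} (β : ℕ) (Q : SetSystem m) → ℕ → Subset m → Dist (List (Fin m))
strategy β Q zero    Y = return (members Y)   -- |Y| = 1: one request at its point
strategy β Q (suc l) Y = rep (β * (⌈ nseq l /2⌉ + 1))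
  where
    rep : ℕ → Dist (List _)
    rep zero    = return []
    rep (suc r) = (uniform (Q (suc l) Y) >>= strategy β Q l) >>= λ s →
                  rep r >>= λ t → return (s ++ t)

allTrue : {m : ℕ} → Subset m → Bool
allTrue []       = true
allTrue (b ∷ bs) = b ∧ allTrue bs

-- adversary(k) with k = suc k', on P = Fin (n_{k-1}+1), run for at most
-- `fuel` iterations of the loop. Outcome: (terminated?, request sequence),
-- starting from the set M of already marked points.
adversaryFuel : (β k' : ℕ) (Q : SetSystem (suc (nseq k'))) → ℕ →
                Subset (suc (nseq k')) → Dist (Bool × List (Fin (suc (nseq k'))))
adversaryFuel β k' Q zero       M = return (false , [])
adversaryFuel β k' Q (suc fuel) M =
  uniform (allFin (suc (nseq k'))) >>= λ p →
    if allTrue (M ∪ ⁅ p ⁆)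
    then return (true , [])
    else (strategy β Q k' (∁ ⁅ p ⁆) >>= λ s →
          adversaryFuel β k' Q fuel (M ∪ ⁅ p ⁆) >>= λ { (b , t) → return (b , s ++ t) })

moveCostFrom : {m k : ℕ} (β w : ℕ) → Vec (Fin m) k → Vec (Fin m) k → ℕ
moveCostFrom β w []       []         = 0
moveCostFrom β w (x ∷ xs) (y ∷ ys) =
  (if ⌊ x ≟ y ⌋ then 0 else w) Data.Nat.+ moveCostFrom β (w Data.Nat.* β) xs ys

moveCost : {m k : ℕ} (β : ℕ) → Vec (Fin m) k → Vec (Fin m) k → ℕ
moveCost β = moveCostFrom β 1

allConfigs : (m k : ℕ) → List (Vec (Fin m) k)
allConfigs m zero    = [] ∷ []
allConfigs m (suc k) = concatMap (λ x → map (x ∷_) (allConfigs m k)) (allFin m)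

covers : {m k : ℕ} → Fin m → Vec (Fin m) k → Bool
covers r []       = false
covers r (x ∷ xs) = ⌊ r ≟ x ⌋ ∨ covers r xs

-- optimal offline cost of serving σ starting from configuration c:
-- minimum over all sequences of configurations c₁, c₂, … with σᵢ ∈ cᵢ of
-- Σ moveCost(cᵢ₋₁, cᵢ). (The default candidate (r ∷ tail c) is itself valid.)
opt : {m k' : ℕ} (β : ℕ) → Vec (Fin m) (suc k') → List (Fin m) → ℕ
opt β c []      = 0
opt {m} {k'} β c (r ∷ σ) =
  foldr (λ c' acc → acc ⊓ (moveCost β c c' Data.Nat.+ opt β c' σ))
        (moveCost β c (r ∷ tail c) Data.Nat.+ opt β (r ∷ tail c) σ)
        (filterᵇ (covers r) (allConfigs m (suc k')))

expectedOptFuel : (β k' : ℕ) (Q : SetSystem (suc (nseq k'))) →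
                  Vec (Fin (suc (nseq k'))) (suc k') → ℕ → ℚ
expectedOptFuel β k' Q c fuel =
  foldr (λ { (p , (b , σ)) acc →
               (if b then p Data.Rational.* fromℕ (opt β c σ) else 0ℚ) Data.Rational.+ acc })
        0ℚ (adversaryFuel β k' Q fuel (Data.Fin.Subset.⊥))

{-# OPTIONS --safe #-}
module Submission where

-- Put the heaviest server on the point h that the adversary marks last. Each call strategy(k-1, P ∖ {p})
-- excludes a point p marked before h, so h lies in the requested set. By induction on ℓ, a request
-- sequence of strategy(ℓ, Y) is served at cost c_ℓ by the ℓ lightest servers alone once a heavier server
-- stands in Y: the server of weight β^{ℓ-1} first moves to the partner q of that heavier server's point,
-- after which every set of 𝒬(Y) holds a server of weight ≥ β^{ℓ-1}, and each of the β(⌈n_{ℓ-1}/2⌉+1)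
-- recursive calls costs c_{ℓ-1}. A finished run therefore costs at most β^{k-1} + (number of calls)·c_{k-1},
-- and the number of calls is a coupon-collector count: with N = n_{k-1}+1 points its expectation is
-- N·H(N) - 1, the final draw ending the run without a call.

open import Defs

open import Data.Bool using (Bool; true; false; if_then_else_; T?)
open import Data.Bool.Properties using (T-≡)
open import Data.Empty using (⊥-elim)
open import Data.Fin as Fin using (Fin; toℕ; fromℕ<; _≟_)
import Data.Fin.Properties as Finₚ
open import Data.Fin.Subset as Subset using (Subset; _∪_; ⁅_⁆; ∁; ∣_∣; _∈_; _∉_; _⊆_)
import Data.Fin.Subset.Properties as Subsetₚ
import Data.Integer as ℤ
import Data.Integer.Properties as ℤₚ
open import Data.List as List using (List; []; _∷_; _++_; map; length; allFin; filterᵇ)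
import Data.List.Properties as Listₚ
open import Data.List.Membership.Propositional using () renaming (_∈_ to _∈ᴸ_)
import Data.List.Membership.Propositional.Properties as ∈ᴸₚ
open import Data.List.Relation.Unary.All as All using (All; []; _∷_)
import Data.List.Relation.Unary.All.Properties as Allₚ
open import Data.List.Relation.Unary.Any as Any using (here; there)
open import Data.Nat as ℕ using (ℕ; zero; suc; _∸_; _^_; _⊓_; ⌈_/2⌉; z≤n; s≤s; NonZero) renaming (_≤_ to _≤ℕ_)
import Data.Nat.Properties as ℕₚ
open import Data.Nat.Coprimality as Coprimality using (1-coprimeTo)
open import Data.Nat.DivMod using (_/_; 0/n≡0; m/n≡1+[m∸n]/n)
open import Data.Product using (∃; _×_; _,_; proj₁; proj₂)
open import Data.Rational as ℚ using (ℚ; 0ℚ; 1ℚ; _-_; _≤_; mkℚ)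
import Data.Rational.Properties as ℚₚ
open import Data.Rational.Solver using (module +-*-Solver)
open import Data.Sum using (_⊎_; inj₁; inj₂)
open import Data.Unit using (⊤; tt)
open import Data.Vec as Vec using (Vec; []; _∷_; lookup; tail; _[_]≔_; here; there)
import Data.Vec.Properties as Vecₚ
open import Function.Bundles using (Equivalence)
open import Relation.Binary.PropositionalEquality using (_≡_; refl; sym; trans; cong; cong₂; subst; module ≡-Reasoning)
open import Relation.Nullary using (¬_; yes; no)
open import Relation.Nullary.Decidable using (⌊_⌋)

module _ where

  open import Data.Rational using (_+_; _*_)
  open +-*-Solver

  fromℕ≡mkℚ : ∀ n → fromℕ n ≡ mkℚ (ℤ.+ n) 0 (Coprimality.sym (1-coprimeTo n))
  fromℕ≡mkℚ n = ℚₚ.normalize-coprime (Coprimality.sym (1-coprimeTo n))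

  fromℕ-+ : ∀ m n → fromℕ m + fromℕ n ≡ fromℕ (m ℕ.+ n)
  fromℕ-+ m n = trans (cong₂ _+_ (fromℕ≡mkℚ m) (fromℕ≡mkℚ n))
    (cong (ℚ._/ 1) (cong₂ ℤ._+_ (ℤₚ.*-identityʳ (ℤ.+ m)) (ℤₚ.*-identityʳ (ℤ.+ n))))

  fromℕ-* : ∀ m n → fromℕ m * fromℕ n ≡ fromℕ (m ℕ.* n)
  fromℕ-* m n = trans (cong₂ _*_ (fromℕ≡mkℚ m) (fromℕ≡mkℚ n)) (cong (ℚ._/ 1) (sym (ℤₚ.pos-* m n)))

  0≤fromℕ : ∀ n → 0ℚ ≤ fromℕ n
  0≤fromℕ n = ℚₚ.nonNegative⁻¹ _ {{ℚₚ.normalize-nonNeg n 1}}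

  fromℕ-mono-≤ : ∀ {m n} → m ≤ℕ n → fromℕ m ≤ fromℕ n
  fromℕ-mono-≤ {m} {n} m≤n = begin
    fromℕ m                   ≡⟨ ℚₚ.+-identityʳ (fromℕ m) ⟨
    fromℕ m + 0ℚ              ≤⟨ ℚₚ.+-monoʳ-≤ (fromℕ m) (0≤fromℕ (n ℕ.∸ m)) ⟩
    fromℕ m + fromℕ (n ℕ.∸ m) ≡⟨ fromℕ-+ m (n ℕ.∸ m) ⟩
    fromℕ (m ℕ.+ (n ℕ.∸ m))   ≡⟨ cong fromℕ (ℕₚ.m+[n∸m]≡n m≤n) ⟩
    fromℕ n                   ∎
    where open ℚₚ.≤-Reasoning

  0≤1/suc : ∀ n → 0ℚ ≤ ℤ.+ 1 ℚ./ suc n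
  0≤1/suc n = ℚₚ.nonNegative⁻¹ _ {{ℚₚ.normalize-nonNeg 1 (suc n)}}

  1/suc*fromℕ≡1 : ∀ n → (ℤ.+ 1 ℚ./ suc n) * fromℕ (suc n) ≡ 1ℚ
  1/suc*fromℕ≡1 n rewrite fromℕ≡mkℚ (suc n) | ℚₚ.normalize-coprime {1} {n} (1-coprimeTo (suc n)) =
    ℚₚ.*-inverseˡ (mkℚ (ℤ.+ suc n) 0 (Coprimality.sym (1-coprimeTo (suc n))))

  *-mono-≤-nonNegˡ : ∀ {r p q} → 0ℚ ≤ r → p ≤ q → r * p ≤ r * q
  *-mono-≤-nonNegˡ {r} 0≤r = ℚₚ.*-monoˡ-≤-nonNeg r {{ℚ.nonNegative 0≤r}}

  0≤* : ∀ {p q} → 0ℚ ≤ p → 0ℚ ≤ q → 0ℚ ≤ p * q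
  0≤* {p} {q} 0≤p 0≤q =
    ℚₚ.nonNegative⁻¹ _ {{ℚₚ.nonNeg*nonNeg⇒nonNeg p {{ℚ.nonNegative 0≤p}} q {{ℚ.nonNegative 0≤q}}}}

  1≤H-suc : ∀ n → 1ℚ ≤ H (suc n)
  1≤H-suc zero    = ℚₚ.≤-reflexive (ℚₚ.+-identityˡ 1ℚ)
  1≤H-suc (suc n) = ℚₚ.≤-trans (1≤H-suc n)
    (ℚₚ.≤-trans (ℚₚ.≤-reflexive (sym (ℚₚ.+-identityʳ (H (suc n))))) (ℚₚ.+-monoʳ-≤ (H (suc n)) (0≤1/suc (suc n))))

  0≤H : ∀ n → 0ℚ ≤ H n
  0≤H zero    = ℚₚ.≤-refl
  0≤H (suc n) = ℚₚ.≤-trans (ℚₚ.nonNegative⁻¹ 1ℚ) (1≤H-suc n)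

  1≤fromℕ-suc*H-suc : ∀ n v → 1ℚ ≤ fromℕ (suc n) * H (suc v)
  1≤fromℕ-suc*H-suc n v = begin
    1ℚ                      ≡⟨ ℚₚ.*-identityˡ 1ℚ ⟨
    1ℚ * 1ℚ                 ≤⟨ ℚₚ.*-monoʳ-≤-nonNeg 1ℚ (fromℕ-mono-≤ {1} {suc n} (s≤s z≤n)) ⟩
    fromℕ (suc n) * 1ℚ      ≤⟨ *-mono-≤-nonNegˡ (0≤fromℕ (suc n)) (1≤H-suc v) ⟩
    fromℕ (suc n) * H (suc v) ∎
    where open ℚₚ.≤-Reasoning

  𝔼 : {A : Set} → Dist A → (A → ℚ) → ℚ
  𝔼 []            F = 0ℚ
  𝔼 ((p , a) ∷ d) F = p * F a + 𝔼 d F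

  Surely : {A : Set} → (A → Set) → Dist A → Set
  Surely P = All (λ (p , a) → 0ℚ ≤ p × P a)

  SubProb : {A : Set} → Dist A → Set
  SubProb d = Surely (λ _ → ⊤) d × 𝔼 d (λ _ → 1ℚ) ≤ 1ℚ

  module _ {A : Set} where

    𝔼-++ : (d e : Dist A) (F : A → ℚ) → 𝔼 (d ++ e) F ≡ 𝔼 d F + 𝔼 e F
    𝔼-++ []            e F = sym (ℚₚ.+-identityˡ _)
    𝔼-++ ((p , a) ∷ d) e F = trans (cong (p * F a +_) (𝔼-++ d e F)) (sym (ℚₚ.+-assoc (p * F a) (𝔼 d F) (𝔼 e F)))

    𝔼-return : (a : A) (F : A → ℚ) → 𝔼 (return a) F ≡ F a
    𝔼-return a F = trans (ℚₚ.+-identityʳ _) (ℚₚ.*-identityˡ _)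

    𝔼-+ : (d : Dist A) (F G : A → ℚ) → 𝔼 d (λ a → F a + G a) ≡ 𝔼 d F + 𝔼 d G
    𝔼-+ []            F G = refl
    𝔼-+ ((p , a) ∷ d) F G rewrite 𝔼-+ d F G =
      solve 5 (λ p f g x y → p :* (f :+ g) :+ (x :+ y) := (p :* f :+ x) :+ (p :* g :+ y)) refl p (F a) (G a) (𝔼 d F) (𝔼 d G)

    𝔼-* : (d : Dist A) (c : ℚ) (F : A → ℚ) → 𝔼 d (λ a → c * F a) ≡ c * 𝔼 d F
    𝔼-* []            c F = sym (ℚₚ.*-zeroʳ c)
    𝔼-* ((p , a) ∷ d) c F rewrite 𝔼-* d c F =
      solve 4 (λ p c f x → p :* (c :* f) :+ c :* x := c :* (p :* f :+ x)) refl p c (F a) (𝔼 d F)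

    𝔼-cong : (d : Dist A) {F G : A → ℚ} → (∀ a → F a ≡ G a) → 𝔼 d F ≡ 𝔼 d G
    𝔼-cong []            F≡G = refl
    𝔼-cong ((p , a) ∷ d) F≡G = cong₂ (λ x y → p * x + y) (F≡G a) (𝔼-cong d F≡G)

    𝔼-mono : (d : Dist A) {F G : A → ℚ} → Surely (λ a → F a ≤ G a) d → 𝔼 d F ≤ 𝔼 d G
    𝔼-mono []            []                = ℚₚ.≤-refl
    𝔼-mono ((p , a) ∷ d) ((0≤p , F≤G) ∷ h) = ℚₚ.+-mono-≤ (*-mono-≤-nonNegˡ 0≤p F≤G) (𝔼-mono d h)

    Surely-map : {P R : A → Set} → (∀ {a} → P a → R a) → {d : Dist A} → Surely P d → Surely R d
    Surely-map f = All.map (λ (0≤p , pa) → 0≤p , f pa)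

    Surely-zip : {P R : A → Set} {d : Dist A} → Surely P d → Surely R d → Surely (λ a → P a × R a) d
    Surely-zip []                  []              = []
    Surely-zip ((0≤p , pa) ∷ hP) ((_ , ra) ∷ hR) = (0≤p , pa , ra) ∷ Surely-zip hP hR

    Surely-return : {P : A → Set} {a : A} → P a → Surely P (return a)
    Surely-return pa = (ℚₚ.nonNegative⁻¹ 1ℚ , pa) ∷ []

    𝔼-≤-bound : (d : Dist A) {F : A → ℚ} {b : ℚ} → SubProb d → 0ℚ ≤ b → Surely (λ a → F a ≤ b) d → 𝔼 d F ≤ b
    𝔼-≤-bound d {F} {b} (_ , mass≤1) 0≤b F≤b = begin
      𝔼 d F             ≤⟨ 𝔼-mono d F≤b ⟩
      𝔼 d (λ _ → b)     ≡⟨ 𝔼-const ⟩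
      b * 𝔼 d (λ _ → 1ℚ) ≤⟨ *-mono-≤-nonNegˡ 0≤b mass≤1 ⟩
      b * 1ℚ            ≡⟨ ℚₚ.*-identityʳ b ⟩
      b                 ∎
      where
      open ℚₚ.≤-Reasoning
      𝔼-const : 𝔼 d (λ _ → b) ≡ b * 𝔼 d (λ _ → 1ℚ)
      𝔼-const = trans (𝔼-cong d (λ _ → sym (ℚₚ.*-identityʳ b))) (𝔼-* d b (λ _ → 1ℚ))

  module _ {A B : Set} where

    private
      scale : ℚ → Dist B → Dist B
      scale p = map (λ (q , b) → (p * q , b))

      𝔼-scale : (p : ℚ) (e : Dist B) (F : B → ℚ) → 𝔼 (scale p e) F ≡ p * 𝔼 e F
      𝔼-scale p []            F = sym (ℚₚ.*-zeroʳ p)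
      𝔼-scale p ((q , b) ∷ e) F rewrite 𝔼-scale p e F =
        solve 4 (λ p q f x → (p :* q) :* f :+ p :* x := p :* (q :* f :+ x)) refl p q (F b) (𝔼 e F)

      Surely-scale : {R : B → Set} {p : ℚ} → 0ℚ ≤ p → {e : Dist B} → Surely R e → Surely R (scale p e)
      Surely-scale 0≤p []                  = []
      Surely-scale 0≤p ((0≤q , rb) ∷ h) = (0≤* 0≤p 0≤q , rb) ∷ Surely-scale 0≤p h

    𝔼->>= : (d : Dist A) (f : A → Dist B) (F : B → ℚ) → 𝔼 (d >>= f) F ≡ 𝔼 d (λ a → 𝔼 (f a) F)
    𝔼->>= []            f F = refl
    𝔼->>= ((p , a) ∷ d) f F =
      trans (𝔼-++ (scale p (f a)) (d >>= f) F) (cong₂ _+_ (𝔼-scale p (f a) F) (𝔼->>= d f F))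

    Surely->>= : {P : A → Set} {R : B → Set} {d : Dist A} {f : A → Dist B} →
                 Surely P d → (∀ {a} → P a → Surely R (f a)) → Surely R (d >>= f)
    Surely->>= {d = []}           []                hf = []
    Surely->>= {d = (p , a) ∷ d} ((0≤p , pa) ∷ h) hf = Allₚ.++⁺ (Surely-scale 0≤p (hf pa)) (Surely->>= h hf)

    SubProb->>= : {d : Dist A} {f : A → Dist B} → SubProb d → (∀ a → SubProb (f a)) → SubProb (d >>= f)
    SubProb->>= {d} {f} (sure , mass≤1) hf = Surely->>= sure (λ {a} _ → proj₁ (hf a)) , (begin
      𝔼 (d >>= f) (λ _ → 1ℚ)           ≡⟨ 𝔼->>= d f (λ _ → 1ℚ) ⟩
      𝔼 d (λ a → 𝔼 (f a) (λ _ → 1ℚ))  ≤⟨ 𝔼-mono d (Surely-map (λ {a} _ → proj₂ (hf a)) sure) ⟩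
      𝔼 d (λ _ → 1ℚ)                   ≤⟨ mass≤1 ⟩
      1ℚ                                ∎)
      where open ℚₚ.≤-Reasoning

  SubProb-return : {A : Set} (a : A) → SubProb (return a)
  SubProb-return a = Surely-return tt , ℚₚ.≤-reflexive (𝔼-return a (λ _ → 1ℚ))

  ∑ : {n : ℕ} → (Fin n → ℚ) → ℚ
  ∑ {zero}  g = 0ℚ
  ∑ {suc n} g = g Fin.zero + ∑ (λ i → g (Fin.suc i))

  module _ {A : Set} where

    ∑ᴸ : List A → (A → ℚ) → ℚ
    ∑ᴸ xs F = List.foldr (λ x acc → F x + acc) 0ℚ xs

    ∑ᴸ-tabulate : {n : ℕ} (g : Fin n → A) (F : A → ℚ) → ∑ᴸ (List.tabulate g) F ≡ ∑ (λ i → F (g i))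
    ∑ᴸ-tabulate {zero}  g F = refl
    ∑ᴸ-tabulate {suc n} g F = cong (F (g Fin.zero) +_) (∑ᴸ-tabulate (λ i → g (Fin.suc i)) F)

    ∑ᴸ-1 : (xs : List A) → ∑ᴸ xs (λ _ → 1ℚ) ≡ fromℕ (length xs)
    ∑ᴸ-1 []       = refl
    ∑ᴸ-1 (x ∷ xs) = trans (cong (1ℚ +_) (∑ᴸ-1 xs)) (fromℕ-+ 1 (length xs))

    𝔼-uniform : (x : A) (xs : List A) (F : A → ℚ) →
                𝔼 (uniform (x ∷ xs)) F ≡ (ℤ.+ 1 ℚ./ suc (length xs)) * ∑ᴸ (x ∷ xs) F
    𝔼-uniform x xs F = 𝔼-weighted (x ∷ xs)
      where
      w = ℤ.+ 1 ℚ./ suc (length xs)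
      𝔼-weighted : (ys : List A) → 𝔼 (map (λ y → (w , y)) ys) F ≡ w * ∑ᴸ ys F
      𝔼-weighted []       = sym (ℚₚ.*-zeroʳ w)
      𝔼-weighted (y ∷ ys) = trans (cong (w * F y +_) (𝔼-weighted ys)) (sym (ℚₚ.*-distribˡ-+ w (F y) (∑ᴸ ys F)))

    Surely-uniform : (xs : List A) → Surely (_∈ᴸ xs) (uniform xs)
    Surely-uniform []       = []
    Surely-uniform (x ∷ xs) = Allₚ.map⁺ (All.tabulate (λ y∈ → 0≤1/suc (length xs) , y∈))

    SubProb-uniform : (xs : List A) → SubProb (uniform xs)
    SubProb-uniform []       = [] , ℚₚ.nonNegative⁻¹ 1ℚ
    SubProb-uniform (x ∷ xs) = Surely-map (λ _ → tt) (Surely-uniform (x ∷ xs)) , ℚₚ.≤-reflexive (begin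
      𝔼 (uniform (x ∷ xs)) (λ _ → 1ℚ)                            ≡⟨ 𝔼-uniform x xs (λ _ → 1ℚ) ⟩
      (ℤ.+ 1 ℚ./ suc (length xs)) * ∑ᴸ (x ∷ xs) (λ _ → 1ℚ)      ≡⟨ cong ((ℤ.+ 1 ℚ./ suc (length xs)) *_) (∑ᴸ-1 (x ∷ xs)) ⟩
      (ℤ.+ 1 ℚ./ suc (length xs)) * fromℕ (suc (length xs))    ≡⟨ 1/suc*fromℕ≡1 (length xs) ⟩
      1ℚ                                                        ∎)
      where open ≡-Reasoning

  𝔼-uniform-allFin : ∀ n (F : Fin (suc n) → ℚ) → 𝔼 (uniform (allFin (suc n))) F ≡ (ℤ.+ 1 ℚ./ suc n) * ∑ F
  𝔼-uniform-allFin n F = trans (𝔼-uniform Fin.zero (List.tabulate Fin.suc) F)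
    (cong₂ (λ k s → (ℤ.+ 1 ℚ./ suc k) * s) (Listₚ.length-tabulate {n = n} Fin.suc) (∑ᴸ-tabulate (λ i → i) F))

  module _ {n : ℕ} where

    ∣p∣+∣∁p∣≡n : (M : Subset n) → ∣ M ∣ ℕ.+ ∣ ∁ M ∣ ≡ n
    ∣p∣+∣∁p∣≡n M = trans (cong (∣ M ∣ ℕ.+_) (Subsetₚ.∣∁p∣≡n∸∣p∣ M)) (ℕₚ.m+[n∸m]≡n (Subsetₚ.∣p∣≤n M))

    x∈p⇒p∪⁅x⁆≡p : {M : Subset n} {p : Fin n} → p ∈ M → M ∪ ⁅ p ⁆ ≡ M
    x∈p⇒p∪⁅x⁆≡p {M} {p} p∈M = Subsetₚ.⊆-antisym ⊆M (Subsetₚ.p⊆p∪q ⁅ p ⁆)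
      where
      ⊆M : M ∪ ⁅ p ⁆ ⊆ M
      ⊆M x∈ with Subsetₚ.x∈p∪q⁻ M ⁅ p ⁆ x∈
      ... | inj₁ x∈M  = x∈M
      ... | inj₂ x∈⁅p⁆ = subst (_∈ M) (sym (Subsetₚ.x∈⁅y⁆⇒x≡y p x∈⁅p⁆)) p∈M

  ∣∁⊥∣≡n : ∀ n → ∣ ∁ (Subset.⊥ {n}) ∣ ≡ n
  ∣∁⊥∣≡n n = trans (Subsetₚ.∣∁p∣≡n∸∣p∣ (Subset.⊥ {n})) (cong (n ∸_) (Subsetₚ.∣⊥∣≡0 n))

  ∣∁p∣≡0⇒allTrue : ∀ {n} (M : Subset n) → ∣ ∁ M ∣ ≡ 0 → allTrue M ≡ true
  ∣∁p∣≡0⇒allTrue []         _    = refl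
  ∣∁p∣≡0⇒allTrue (true ∷ M) ∣∁M∣≡0 = ∣∁p∣≡0⇒allTrue M ∣∁M∣≡0

  allTrue⇒∣∁p∣≡0 : ∀ {n} (M : Subset n) → allTrue M ≡ true → ∣ ∁ M ∣ ≡ 0
  allTrue⇒∣∁p∣≡0 []         _   = refl
  allTrue⇒∣∁p∣≡0 (true ∷ M) all = allTrue⇒∣∁p∣≡0 M all

  x∉p⇒∣∁p∣≡1+∣∁p∪⁅x⁆∣ : ∀ {n} (M : Subset n) {p} → p ∉ M → ∣ ∁ M ∣ ≡ suc ∣ ∁ (M ∪ ⁅ p ⁆) ∣
  x∉p⇒∣∁p∣≡1+∣∁p∪⁅x⁆∣ (true  ∷ M) {Fin.zero}  p∉M = ⊥-elim (p∉M here)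
  x∉p⇒∣∁p∣≡1+∣∁p∪⁅x⁆∣ (false ∷ M) {Fin.zero}  p∉M = cong (λ M′ → suc ∣ ∁ M′ ∣) (sym (Subsetₚ.∪-identityʳ M))
  x∉p⇒∣∁p∣≡1+∣∁p∪⁅x⁆∣ (true  ∷ M) {Fin.suc p} p∉M = x∉p⇒∣∁p∣≡1+∣∁p∪⁅x⁆∣ M (λ p∈M → p∉M (there p∈M))
  x∉p⇒∣∁p∣≡1+∣∁p∪⁅x⁆∣ (false ∷ M) {Fin.suc p} p∉M = cong suc (x∉p⇒∣∁p∣≡1+∣∁p∪⁅x⁆∣ M (λ p∈M → p∉M (there p∈M)))

  ∑-≤-split : ∀ {n} (M : Subset n) (g : Fin n → ℚ) {a b} →
    (∀ {p} → p ∈ M → g p ≤ a) → (∀ {p} → p ∉ M → g p ≤ b) → ∑ g ≤ fromℕ ∣ M ∣ * a + fromℕ ∣ ∁ M ∣ * b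
  ∑-≤-split [] g {a} {b} _ _ = ℚₚ.≤-reflexive (sym (solve 2 (λ a b → con 0ℚ :* a :+ con 0ℚ :* b := con 0ℚ) refl a b))
  ∑-≤-split (true ∷ M) g {a} {b} g≤a g≤b = begin
    g Fin.zero + ∑ (λ i → g (Fin.suc i))            ≤⟨ ℚₚ.+-mono-≤ (g≤a here) ih ⟩
    a + (fromℕ ∣ M ∣ * a + fromℕ ∣ ∁ M ∣ * b)
      ≡⟨ solve 4 (λ a b x y → a :+ (x :* a :+ y :* b) := (con 1ℚ :+ x) :* a :+ y :* b)
                 refl a b (fromℕ ∣ M ∣) (fromℕ ∣ ∁ M ∣) ⟩
    (1ℚ + fromℕ ∣ M ∣) * a + fromℕ ∣ ∁ M ∣ * b       ≡⟨ cong (λ x → x * a + fromℕ ∣ ∁ M ∣ * b) (fromℕ-+ 1 ∣ M ∣) ⟩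
    fromℕ (suc ∣ M ∣) * a + fromℕ ∣ ∁ M ∣ * b        ∎
    where
    open ℚₚ.≤-Reasoning
    ih = ∑-≤-split M (λ i → g (Fin.suc i)) (λ p∈M → g≤a (there p∈M)) (λ p∉M → g≤b (λ { (there p∈M) → p∉M p∈M }))
  ∑-≤-split (false ∷ M) g {a} {b} g≤a g≤b = begin
    g Fin.zero + ∑ (λ i → g (Fin.suc i))            ≤⟨ ℚₚ.+-mono-≤ (g≤b (λ ())) ih ⟩
    b + (fromℕ ∣ M ∣ * a + fromℕ ∣ ∁ M ∣ * b)
      ≡⟨ solve 4 (λ a b x y → b :+ (x :* a :+ y :* b) := x :* a :+ (con 1ℚ :+ y) :* b)
                 refl a b (fromℕ ∣ M ∣) (fromℕ ∣ ∁ M ∣) ⟩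
    fromℕ ∣ M ∣ * a + (1ℚ + fromℕ ∣ ∁ M ∣) * b       ≡⟨ cong (λ y → fromℕ ∣ M ∣ * a + y * b) (fromℕ-+ 1 ∣ ∁ M ∣) ⟩
    fromℕ ∣ M ∣ * a + fromℕ (suc ∣ ∁ M ∣) * b        ∎
    where
    open ℚₚ.≤-Reasoning
    ih = ∑-≤-split M (λ i → g (Fin.suc i)) (λ p∈M → g≤a (there p∈M)) (λ p∉M → g≤b (λ { (there p∈M) → p∉M p∈M }))

  -- The coupon-collector recurrence: averaging the bound N·H(v+1) over the m marked points and N·H(v) over
  -- the v + 1 unmarked ones gives N·H(v+1) - 1.
  coupon-step : ∀ n m v → m ℕ.+ suc v ≡ suc n →
    (ℤ.+ 1 ℚ./ suc n) * (fromℕ m * (fromℕ (suc n) * H (suc v)) + fromℕ (suc v) * (fromℕ (suc n) * H v))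
      ≡ fromℕ (suc n) * H (suc v) - 1ℚ
  coupon-step n m v m+u≡N = begin
    w * (x * (N * (h + i)) + u * (N * h)) ≡⟨ solve 6 (λ w x u N h i → w :* (x :* (N :* (h :+ i)) :+ u :* (N :* h))
                                                                := (w :* N) :* ((x :+ u) :* (h :+ i) :- u :* i))
                                                    refl w x u N h i ⟩
    (w * N) * ((x + u) * (h + i) - u * i) ≡⟨ cong₂ (λ a b → a * ((b * (h + i)) - u * i)) (1/suc*fromℕ≡1 n) x+u≡N ⟩
    1ℚ * (N * (h + i) - u * i)             ≡⟨ cong (λ a → 1ℚ * (N * (h + i) - a)) (trans (ℚₚ.*-comm u i) (1/suc*fromℕ≡1 v)) ⟩
    1ℚ * (N * (h + i) - 1ℚ)                ≡⟨ ℚₚ.*-identityˡ _ ⟩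
    N * (h + i) - 1ℚ                       ∎
    where
    open ≡-Reasoning
    w = ℤ.+ 1 ℚ./ suc n
    N = fromℕ (suc n)
    x = fromℕ m
    u = fromℕ (suc v)
    h = H v
    i = ℤ.+ 1 ℚ./ suc v
    x+u≡N : x + u ≡ N
    x+u≡N = trans (fromℕ-+ m (suc v)) (cong fromℕ m+u≡N)

  module _ {X : Set} where

    repeatedly : ℕ → Dist (List X) → Dist (List X)
    repeatedly zero    d = return []
    repeatedly (suc r) d = d >>= λ s → repeatedly r d >>= λ t → return (s ++ t)

    Surely-repeatedly : {P : List X → Set} {Φ : ℕ → List X → Set} {d : Dist (List X)} → Surely P d →
      Φ 0 [] → (∀ r {s t} → P s → Φ r t → Φ (suc r) (s ++ t)) → ∀ n → Surely (Φ n) (repeatedly n d)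
    Surely-repeatedly sure Φ[] Φ++ zero    = Surely-return Φ[]
    Surely-repeatedly sure Φ[] Φ++ (suc n) =
      Surely->>= sure λ ps → Surely->>= (Surely-repeatedly sure Φ[] Φ++ n) λ φt → Surely-return (Φ++ n ps φt)

    repeatedly-unique : (d : Dist (List X)) (f : ℕ → Dist (List X)) → f 0 ≡ return [] →
      (∀ r → f (suc r) ≡ (d >>= λ s → f r >>= λ t → return (s ++ t))) → ∀ n → f n ≡ repeatedly n d
    repeatedly-unique d f f0 fsuc zero    = f0
    repeatedly-unique d f f0 fsuc (suc n) rewrite fsuc n =
      cong (λ x → d >>= λ s → x >>= λ t → return (s ++ t)) (repeatedly-unique d f f0 fsuc n)

    SubProb-repeatedly : {d : Dist (List X)} → SubProb d → ∀ n → SubProb (repeatedly n d)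
    SubProb-repeatedly sd zero    = SubProb-return []
    SubProb-repeatedly sd (suc n) =
      SubProb->>= sd λ s → SubProb->>= (SubProb-repeatedly sd n) λ t → SubProb-return (s ++ t)

  strategy-suc : {m : ℕ} (β : ℕ) (Q : SetSystem m) (l : ℕ) (Y : Subset m) →
    strategy β Q (suc l) Y ≡ repeatedly (β ℕ.* (⌈ nseq l /2⌉ ℕ.+ 1)) (uniform (Q (suc l) Y) >>= strategy β Q l)
  -- The with-abstraction over the repetition count exposes the local loop of strategy as a function.
  strategy-suc β Q l Y with repeatedly-unique (uniform (Q (suc l) Y) >>= strategy β Q l) _ refl (λ _ → refl)
                           | β ℕ.* (⌈ nseq l /2⌉ ℕ.+ 1)
  ... | rep≡repeatedly | n = rep≡repeatedly n

module _ where

  open import Data.Nat using (_+_; _*_)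
  open import Algebra.Properties.CommutativeSemigroup ℕₚ.+-commutativeSemigroup using () renaming (interchange to +-interchange)

  module _ {V : Set} (g : V → ℕ) where

    foldr-⊓ : ℕ → List V → ℕ
    foldr-⊓ init = List.foldr (λ v acc → acc ⊓ g v) init

    foldr-⊓-≤ : ∀ init {xs v} → v ∈ᴸ xs → foldr-⊓ init xs ≤ℕ g v
    foldr-⊓-≤ init {y ∷ xs} (here refl) = ℕₚ.m⊓n≤n (foldr-⊓ init xs) (g y)
    foldr-⊓-≤ init {y ∷ xs} (there v∈) = ℕₚ.≤-trans (ℕₚ.m⊓n≤m (foldr-⊓ init xs) (g y)) (foldr-⊓-≤ init v∈)

    foldr-⊓-attained : ∀ init xs → foldr-⊓ init xs ≡ init ⊎ ∃ λ v → v ∈ᴸ xs × foldr-⊓ init xs ≡ g v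
    foldr-⊓-attained init []       = inj₁ refl
    foldr-⊓-attained init (y ∷ xs) with ℕₚ.⊓-sel (foldr-⊓ init xs) (g y)
    ... | inj₂ eq = inj₂ (y , here refl , eq)
    ... | inj₁ eq with foldr-⊓-attained init xs
    ...   | inj₁ eq′             = inj₁ (trans eq eq′)
    ...   | inj₂ (v , v∈ , eq′) = inj₂ (v , there v∈ , trans eq eq′)

  allConfigs-complete : ∀ m k (c : Vec (Fin m) k) → c ∈ᴸ allConfigs m k
  allConfigs-complete m zero    []      = here refl
  allConfigs-complete m (suc k) (x ∷ c) =
    ∈ᴸₚ.∈-concatMap⁺ (λ y → List.map (y Vec.∷_) (allConfigs m k)) {xs = List.allFin m}
      (Any.map (λ { refl → ∈ᴸₚ.∈-map⁺ (x Vec.∷_) (allConfigs-complete m k c) }) (∈ᴸₚ.∈-allFin x))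

  module _ {m : ℕ} where

    covers-lookup : ∀ {n} (c : Vec (Fin m) n) j → covers (lookup c j) c ≡ true
    covers-lookup (x ∷ c) Fin.zero with x ≟ x
    ... | yes _ = refl
    ... | no x≢x = ⊥-elim (x≢x refl)
    covers-lookup (x ∷ c) (Fin.suc j) with lookup c j ≟ x
    ... | yes _ = refl
    ... | no _  = covers-lookup c j

    stepCost : ℕ → Fin m → Fin m → ℕ
    stepCost w x y = if ⌊ x ≟ y ⌋ then 0 else w

    stepCost-triangle : ∀ w x y z → stepCost w x z ≤ℕ stepCost w x y + stepCost w y z
    stepCost-triangle w x y z with x ≟ z
    ... | yes _ = z≤n
    ... | no x≢z with x ≟ y
    ...   | no _     = ℕₚ.m≤m+n w _
    ...   | yes refl with x ≟ z
    ...     | yes x≡z = ⊥-elim (x≢z x≡z)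
    ...     | no _    = ℕₚ.≤-refl

    module _ (β : ℕ) where

      moveCostFrom-refl : ∀ {n} w (c : Vec (Fin m) n) → moveCostFrom β w c c ≡ 0
      moveCostFrom-refl w []       = refl
      moveCostFrom-refl w (x ∷ c) with x ≟ x
      ... | yes _  = moveCostFrom-refl (w * β) c
      ... | no x≢x = ⊥-elim (x≢x refl)

      moveCostFrom-triangle : ∀ {n} w (a b c : Vec (Fin m) n) →
        moveCostFrom β w a c ≤ℕ moveCostFrom β w a b + moveCostFrom β w b c
      moveCostFrom-triangle w [] [] []      = z≤n
      moveCostFrom-triangle w (x ∷ a) (y ∷ b) (z ∷ c) = ℕₚ.≤-trans
        (ℕₚ.+-mono-≤ (stepCost-triangle w x y z) (moveCostFrom-triangle (w * β) a b c))
        (ℕₚ.≤-reflexive (+-interchange (stepCost w x y) (stepCost w y z) _ _))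

      moveCostFrom-update : ∀ {n} w (c : Vec (Fin m) n) i x → moveCostFrom β w c (c [ i ]≔ x) ≤ℕ w * β ^ toℕ i
      moveCostFrom-update w (y ∷ c) Fin.zero x with y ≟ x
      ... | yes _ = ℕₚ.≤-trans (ℕₚ.≤-reflexive (moveCostFrom-refl (w * β) c)) z≤n
      ... | no _  = ℕₚ.≤-reflexive (trans (cong (w +_) (moveCostFrom-refl (w * β) c))
                                          (trans (ℕₚ.+-identityʳ w) (sym (ℕₚ.*-identityʳ w))))
      moveCostFrom-update w (y ∷ c) (Fin.suc i) x with y ≟ y
      ... | yes _  = ℕₚ.≤-trans (moveCostFrom-update (w * β) c i x) (ℕₚ.≤-reflexive (ℕₚ.*-assoc w β (β ^ toℕ i)))
      ... | no y≢y = ⊥-elim (y≢y refl)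

  module Offline (β : ℕ) {m k : ℕ} where

    Config : Set
    Config = Vec (Fin m) (suc k)

    private
      candidates : Fin m → List Config
      candidates r = filterᵇ (covers r) (allConfigs m (suc k))

      ∈-candidates⁺ : ∀ {r} c → covers r c ≡ true → c ∈ᴸ candidates r
      ∈-candidates⁺ {r} c cov =
        ∈ᴸₚ.∈-filter⁺ (λ y → T? (covers r y)) (allConfigs-complete m (suc k) c) (Equivalence.from T-≡ cov)

      ∈-candidates⁻ : ∀ {r c} → c ∈ᴸ candidates r → covers r c ≡ true
      ∈-candidates⁻ {r} c∈ = Equivalence.to T-≡ (proj₂ (∈ᴸₚ.∈-filter⁻ (λ y → T? (covers r y)) {xs = allConfigs m (suc k)} c∈))

    opt-∷-≤ : ∀ (c c′ : Config) r σ → covers r c′ ≡ true → opt β c (r ∷ σ) ≤ℕ moveCost β c c′ + opt β c′ σ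
    opt-∷-≤ c c′ r σ cov = foldr-⊓-≤ (λ c′ → moveCost β c c′ + opt β c′ σ) _ (∈-candidates⁺ c′ cov)

    opt-∷-attained : ∀ (c : Config) r σ → ∃ λ c′ → covers r c′ ≡ true × opt β c (r ∷ σ) ≡ moveCost β c c′ + opt β c′ σ
    opt-∷-attained c r σ with foldr-⊓-attained (λ c′ → moveCost β c c′ + opt β c′ σ) _ (candidates r)
    ... | inj₁ eq              = r Vec.∷ tail c , covers-lookup (r Vec.∷ tail c) Fin.zero , eq
    ... | inj₂ (c′ , c′∈ , eq) = c′ , ∈-candidates⁻ c′∈ , eq

    opt-≤-move : ∀ σ (c c₁ : Config) → opt β c σ ≤ℕ moveCost β c c₁ + opt β c₁ σ
    opt-≤-move []      c c₁ = z≤n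
    opt-≤-move (r ∷ σ) c c₁ with opt-∷-attained c₁ r σ
    ... | c′ , cov , eq = begin
      opt β c (r ∷ σ)                                   ≤⟨ opt-∷-≤ c c′ r σ cov ⟩
      moveCost β c c′ + opt β c′ σ                      ≤⟨ ℕₚ.+-monoˡ-≤ _ (moveCostFrom-triangle β 1 c c₁ c′) ⟩
      (moveCost β c c₁ + moveCost β c₁ c′) + opt β c′ σ ≡⟨ ℕₚ.+-assoc (moveCost β c c₁) _ _ ⟩
      moveCost β c c₁ + (moveCost β c₁ c′ + opt β c′ σ) ≡⟨ cong (moveCost β c c₁ +_) eq ⟨
      moveCost β c c₁ + opt β c₁ (r ∷ σ)                ∎
      where open ℕₚ.≤-Reasoning

    -- "σ can be served from c ending in c′ at cost n", expressed through opt so that it can be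
    -- extended by any continuation τ
    record Serve (c : Config) (σ : List (Fin m)) (c′ : Config) (n : ℕ) : Set where
      constructor serve
      field
        run : ∀ τ → opt β c (σ ++ τ) ≤ℕ n + opt β c′ τ
    open Serve

    Serve-[] : ∀ c → Serve c [] c 0
    Serve-[] c = serve λ τ → ℕₚ.≤-refl

    Serve-covered : ∀ c r → covers r c ≡ true → Serve c (r ∷ []) c 0
    Serve-covered c r cov =
      serve λ τ → ℕₚ.≤-trans (opt-∷-≤ c c r τ cov) (ℕₚ.≤-reflexive (cong (_+ opt β c τ) (moveCostFrom-refl β 1 c)))

    Serve-++ : ∀ {c σ c₁ a σ′ c₂ b} → Serve c σ c₁ a → Serve c₁ σ′ c₂ b → Serve c (σ ++ σ′) c₂ (a + b)
    Serve-++ {c} {σ} {c₁} {a} {σ′} {c₂} {b} s₁ s₂ = serve λ τ → begin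
      opt β c ((σ ++ σ′) ++ τ) ≡⟨ cong (opt β c) (Listₚ.++-assoc σ σ′ τ) ⟩
      opt β c (σ ++ σ′ ++ τ)   ≤⟨ run s₁ (σ′ ++ τ) ⟩
      a + opt β c₁ (σ′ ++ τ)   ≤⟨ ℕₚ.+-monoʳ-≤ a (run s₂ τ) ⟩
      a + (b + opt β c₂ τ)     ≡⟨ ℕₚ.+-assoc a b _ ⟨
      a + b + opt β c₂ τ       ∎
      where open ℕₚ.≤-Reasoning

    Serve-move : ∀ c {c₁ σ c₂ n} → Serve c₁ σ c₂ n → Serve c σ c₂ (moveCost β c c₁ + n)
    Serve-move c {c₁} {σ} {c₂} {n} s = serve λ τ → begin
      opt β c (σ ++ τ)                          ≤⟨ opt-≤-move (σ ++ τ) c c₁ ⟩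
      moveCost β c c₁ + opt β c₁ (σ ++ τ)       ≤⟨ ℕₚ.+-monoʳ-≤ (moveCost β c c₁) (run s τ) ⟩
      moveCost β c c₁ + (n + opt β c₂ τ)        ≡⟨ ℕₚ.+-assoc (moveCost β c c₁) n _ ⟨
      moveCost β c c₁ + n + opt β c₂ τ          ∎
      where open ℕₚ.≤-Reasoning

    Serve-weaken : ∀ {c σ c′ n n′} → n ≤ℕ n′ → Serve c σ c′ n → Serve c σ c′ n′
    Serve-weaken n≤n′ s = serve λ τ → ℕₚ.≤-trans (run s τ) (ℕₚ.+-monoˡ-≤ _ n≤n′)

    opt-≤-Serve : ∀ {c σ c′ n} → Serve c σ c′ n → opt β c σ ≤ℕ n
    opt-≤-Serve {c} {σ} {c′} {n} s = begin
      opt β c σ        ≡⟨ cong (opt β c) (Listₚ.++-identityʳ σ) ⟨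
      opt β c (σ ++ []) ≤⟨ run s [] ⟩
      n + 0             ≡⟨ ℕₚ.+-identityʳ n ⟩
      n                 ∎
      where open ℕₚ.≤-Reasoning

  length-filterᵇ-tabulate : {A : Set} {n : ℕ} (P : A → Bool) (f : Fin n → A) →
    length (filterᵇ P (List.tabulate f)) ≡ ∣ Vec.tabulate (λ i → P (f i)) ∣
  length-filterᵇ-tabulate {n = zero}  P f = refl
  length-filterᵇ-tabulate {n = suc n} P f with P (f Fin.zero)
  ... | true  = cong suc (length-filterᵇ-tabulate P (λ i → f (Fin.suc i)))
  ... | false = length-filterᵇ-tabulate P (λ i → f (Fin.suc i))

  length-members : ∀ {n} (Y : Subset n) → length (members Y) ≡ ∣ Y ∣
  length-members Y = trans (length-filterᵇ-tabulate (lookup Y) (λ i → i)) (cong ∣_∣ (Vecₚ.tabulate∘lookup Y))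

  members-singleton : ∀ {n} {Y : Subset n} {p} → ∣ Y ∣ ≡ 1 → p ∈ Y → members Y ≡ p ∷ []
  members-singleton {n} {Y} {p} ∣Y∣≡1 p∈Y
    with members Y | length-members Y
       | ∈ᴸₚ.∈-filter⁺ (λ y → T? (lookup Y y)) (∈ᴸₚ.∈-allFin p) (Equivalence.from T-≡ (Vecₚ.[]=⇒lookup p∈Y))
  ... | q ∷ []    | _   | here refl = refl
  ... | []        | len | _         = ⊥-elim (ℕₚ.0≢1+n (trans len ∣Y∣≡1))
  ... | _ ∷ _ ∷ _ | len | _         = ⊥-elim (ℕₚ.1+n≢0 (ℕₚ.suc-injective (trans len ∣Y∣≡1)))

  record Admissible {m : ℕ} (Q : SetSystem m) : Set where
    field
      sizes   : ∀ l Y → ∣ Y ∣ ≡ nseq (suc l) → All (λ S → ∣ S ∣ ≡ nseq l) (Q (suc l) Y)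
      partner : ∀ l Y → ∣ Y ∣ ≡ nseq (suc l) → ∀ p → p ∈ Y → ∃ λ q → All (λ S → p ∈ S ⊎ q ∈ S) (Q (suc l) Y)

  strategyLength : ℕ → ℕ → ℕ
  strategyLength β zero    = 1
  strategyLength β (suc l) = β * (⌈ nseq l /2⌉ + 1) * strategyLength β l

  strategyLength-positive : ∀ {β} → 1 ≤ℕ β → ∀ l → 1 ≤ℕ strategyLength β l
  strategyLength-positive 1≤β zero    = ℕₚ.≤-refl
  strategyLength-positive 1≤β (suc l) =
    ℕₚ.*-mono-≤ (ℕₚ.*-mono-≤ 1≤β (ℕₚ.m≤n+m 1 _)) (strategyLength-positive 1≤β l)

  SubProb-strategy : ∀ {m} β (Q : SetSystem m) l Y → SubProb (strategy β Q l Y)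
  SubProb-strategy β Q zero    Y = SubProb-return (members Y)
  SubProb-strategy β Q (suc l) Y rewrite strategy-suc β Q l Y =
    SubProb-repeatedly (SubProb->>= (SubProb-uniform (Q (suc l) Y)) (SubProb-strategy β Q l)) (β * (⌈ nseq l /2⌉ + 1))

  module Strategy (β : ℕ) {m k : ℕ} (Q : SetSystem m) (adm : Admissible Q) where

    open Offline β {m} {k}
    open Admissible adm

    strategy-length : ∀ l Y → ∣ Y ∣ ≡ nseq l → Surely (λ σ → length σ ≡ strategyLength β l) (strategy β Q l Y)
    strategy-length zero    Y ∣Y∣≡1 = Surely-return (trans (length-members Y) ∣Y∣≡1)
    strategy-length (suc l) Y ∣Y∣≡n rewrite strategy-suc β Q l Y =
      Surely-repeatedly {Φ = λ r σ → length σ ≡ r * strategyLength β l} call-length refl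
        (λ _ {s} ls lt → trans (Listₚ.length-++ s) (cong₂ _+_ ls lt)) (β * (⌈ nseq l /2⌉ + 1))
      where
      call-length : Surely (λ σ → length σ ≡ strategyLength β l) (uniform (Q (suc l) Y) >>= strategy β Q l)
      call-length = Surely->>= (Surely-uniform (Q (suc l) Y))
                               (λ S∈ → strategy-length l _ (All.lookup (sizes l Y ∣Y∣≡n) S∈))

    record AgreeFrom (l : ℕ) (c c′ : Config) : Set where
      constructor agreeFrom
      field
        at : ∀ i → l ≤ℕ toℕ i → lookup c′ i ≡ lookup c i
    open AgreeFrom

    AgreeFrom-refl : ∀ {l c} → AgreeFrom l c c
    AgreeFrom-refl = agreeFrom λ _ _ → refl

    AgreeFrom-trans : ∀ {l c c₁ c₂} → AgreeFrom l c c₁ → AgreeFrom l c₁ c₂ → AgreeFrom l c c₂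
    AgreeFrom-trans a₁ a₂ = agreeFrom λ i l≤i → trans (at a₂ i l≤i) (at a₁ i l≤i)

    OccupiedFrom : ℕ → Config → Subset m → Set
    OccupiedFrom l c S = ∃ λ j → l ≤ℕ toℕ j × lookup c j ∈ S

    OccupiedFrom-agree : ∀ {l c c′ S} → AgreeFrom l c c′ → OccupiedFrom l c S → OccupiedFrom l c′ S
    OccupiedFrom-agree agree (j , l≤j , cj∈S) = j , l≤j , subst (_∈ _) (sym (at agree j l≤j)) cj∈S

    ServedBelow : ℕ → Subset m → List (Fin m) → Set
    ServedBelow l Y σ = ∀ c → OccupiedFrom l c Y → ∃ λ c′ → AgreeFrom l c c′ × Serve c σ c′ (cseq β l)

    AgreeFrom-suc : ∀ {l c c′} → AgreeFrom l c c′ → AgreeFrom (suc l) c c′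
    AgreeFrom-suc agree = agreeFrom λ i l<i → at agree i (ℕₚ.<⇒≤ l<i)

    AgreeFrom-update : ∀ c i x → AgreeFrom (suc (toℕ i)) c (c [ i ]≔ x)
    AgreeFrom-update c i x = agreeFrom λ i′ i<i′ → Vecₚ.lookup∘update′ (λ i′≡i → ℕₚ.<-irrefl (cong toℕ (sym i′≡i)) i<i′) c x

    moveCost-update : ∀ (c : Config) i x → moveCost β c (c [ i ]≔ x) ≤ℕ β ^ toℕ i
    moveCost-update c i x = ℕₚ.≤-trans (moveCostFrom-update β 1 c i x) (ℕₚ.≤-reflexive (ℕₚ.*-identityˡ _))

    private
      Qs : ℕ → Subset m → List (Subset m)
      Qs l Y = Q (suc l) Y

      call-served : ∀ l Y → ∣ Y ∣ ≡ nseq (suc l) →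
        (∀ S → ∣ S ∣ ≡ nseq l → Surely (ServedBelow l S) (strategy β Q l S)) →
        Surely (λ s → ∃ λ S → S ∈ᴸ Qs l Y × ServedBelow l S s) (uniform (Qs l Y) >>= strategy β Q l)
      call-served l Y ∣Y∣≡n served = Surely->>= (Surely-uniform (Qs l Y))
        (λ {S} S∈ → Surely-map (λ sb → S , S∈ , sb) (served S (All.lookup (sizes l Y ∣Y∣≡n) S∈)))

      -- the invariant of r iterations of the loop of strategy(l + 1, Y)
      ServedCalls : ℕ → Subset m → ℕ → List (Fin m) → Set
      ServedCalls l Y r σ = ∀ c → (∀ {S} → S ∈ᴸ Qs l Y → OccupiedFrom l c S) →
                            ∃ λ c′ → AgreeFrom l c c′ × Serve c σ c′ (r * cseq β l)

      ServedCalls-[] : ∀ l Y → ServedCalls l Y 0 []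
      ServedCalls-[] l Y c _ = c , AgreeFrom-refl , Serve-[] c

      ServedCalls-++ : ∀ l Y r {s t} → (∃ λ S → S ∈ᴸ Qs l Y × ServedBelow l S s) →
                       ServedCalls l Y r t → ServedCalls l Y (suc r) (s ++ t)
      ServedCalls-++ l Y r (S , S∈ , served-s) served-t c occ
        with served-s c (occ S∈)
      ... | c₁ , agree₁ , serve₁ with served-t c₁ (λ S′∈ → OccupiedFrom-agree agree₁ (occ S′∈))
      ...   | c₂ , agree₂ , serve₂ = c₂ , AgreeFrom-trans agree₁ agree₂ , Serve-++ serve₁ serve₂

      -- The induction step: server l moves to the partner q of the point held by a heavier server,
      -- after which every set of Qs l Y is occupied from l on.
      relocate : ∀ l Y c → ∣ Y ∣ ≡ nseq (suc l) → OccupiedFrom (suc l) c Y →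
        ∃ λ c₁ → AgreeFrom (suc l) c c₁ × moveCost β c c₁ ≤ℕ β ^ l × (∀ {S} → S ∈ᴸ Qs l Y → OccupiedFrom l c₁ S)
      relocate l Y c ∣Y∣≡n (j , l<j , cj∈Y) with partner l Y ∣Y∣≡n (lookup c j) cj∈Y
      ... | q , covered = c₁ , agree , cost , occupied
        where
        l<k : l ℕ.< suc k
        l<k = ℕₚ.<-≤-trans l<j (ℕₚ.<⇒≤ (Finₚ.toℕ<n j))
        i = fromℕ< l<k
        i≡l : toℕ i ≡ l
        i≡l = Finₚ.toℕ-fromℕ< l<k
        c₁ = c [ i ]≔ q
        agree : AgreeFrom (suc l) c c₁
        agree = subst (λ n → AgreeFrom (suc n) c c₁) i≡l (AgreeFrom-update c i q)
        cost : moveCost β c c₁ ≤ℕ β ^ l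
        cost = subst (λ n → moveCost β c c₁ ≤ℕ β ^ n) i≡l (moveCost-update c i q)
        occupied : ∀ {S} → S ∈ᴸ Qs l Y → OccupiedFrom l c₁ S
        occupied S∈ with All.lookup covered S∈
        ... | inj₁ cj∈S = j , ℕₚ.<⇒≤ l<j , subst (_∈ _) (sym (at agree j l<j)) cj∈S
        ... | inj₂ q∈S  = i , ℕₚ.≤-reflexive (sym i≡l) , subst (_∈ _) (sym (Vecₚ.lookup∘update i c q)) q∈S

      ServedCalls⇒ServedBelow : ∀ l Y {σ} → ∣ Y ∣ ≡ nseq (suc l) →
        ServedCalls l Y (β * (⌈ nseq l /2⌉ + 1)) σ → ServedBelow (suc l) Y σ
      ServedCalls⇒ServedBelow l Y ∣Y∣≡n served c occ with relocate l Y c ∣Y∣≡n occ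
      ... | c₁ , agree₁ , cost₁ , occupied₁ with served c₁ occupied₁
      ...   | c′ , agree , serve-σ =
        c′ , AgreeFrom-trans agree₁ (AgreeFrom-suc agree) , Serve-weaken (ℕₚ.+-monoˡ-≤ _ cost₁) (Serve-move c serve-σ)

    strategy-served : ∀ l Y → ∣ Y ∣ ≡ nseq l → Surely (ServedBelow l Y) (strategy β Q l Y)
    strategy-served zero    Y ∣Y∣≡1 = Surely-return served
      where
      served : ServedBelow 0 Y (members Y)
      served c (j , _ , cj∈Y) rewrite members-singleton ∣Y∣≡1 cj∈Y =
        c , AgreeFrom-refl , Serve-covered c (lookup c j) (covers-lookup c j)
    strategy-served (suc l) Y ∣Y∣≡n rewrite strategy-suc β Q l Y =
      Surely-map (ServedCalls⇒ServedBelow l Y ∣Y∣≡n)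
        (Surely-repeatedly {Φ = ServedCalls l Y} (call-served l Y ∣Y∣≡n (strategy-served l))
                           (ServedCalls-[] l Y) (ServedCalls-++ l Y) (β * (⌈ nseq l /2⌉ + 1)))

module _ where

  open import Data.Rational using (_+_; _*_)
  open +-*-Solver

  module Adversary (β : ℕ) (1≤β : 1 ≤ℕ β) (k′ : ℕ) (Q : SetSystem (suc (nseq k′))) (adm : Admissible Q) where

    N : ℕ
    N = suc (nseq k′)

    Point : Set
    Point = Fin N

    Outcome : Set
    Outcome = Bool × List Point

    open Offline β {N} {k′}
    open Strategy β {N} {k′} Q adm

    L : ℕ
    L = strategyLength β k′

    instance
      L-nonZero : NonZero L
      L-nonZero = ℕ.>-nonZero (strategyLength-positive 1≤β k′)

    -- Every call of strategy(k-1, ·) issues exactly L requests, so the number of calls is read off the length.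
    calls : List Point → ℕ
    calls σ = length σ / L

    calls-[] : calls [] ≡ 0
    calls-[] = 0/n≡0 L

    calls-++ : ∀ s t → length s ≡ L → calls (s ++ t) ≡ suc (calls t)
    calls-++ s t ∣s∣≡L = begin
      length (s ++ t) / L          ≡⟨ cong (_/ L) (trans (Listₚ.length-++ s) (cong (ℕ._+ length t) ∣s∣≡L)) ⟩
      (L ℕ.+ length t) / L           ≡⟨ m/n≡1+[m∸n]/n (ℕₚ.m≤m+n L (length t)) ⟩
      suc ((L ℕ.+ length t ∸ L) / L) ≡⟨ cong (λ n → suc (n / L)) (ℕₚ.m+n∸m≡n L (length t)) ⟩
      suc (length t / L)           ∎
      where open ≡-Reasoning

    call : Point → Dist (List Point)
    call p = strategy β Q k′ (∁ ⁅ p ⁆)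

    ∣∁⁅p⁆∣ : ∀ p → ∣ ∁ ⁅ p ⁆ ∣ ≡ nseq k′
    ∣∁⁅p⁆∣ p = trans (Subsetₚ.∣∁p∣≡n∸∣p∣ ⁅ p ⁆) (cong (N ∸_) (Subsetₚ.∣⁅x⁆∣≡1 p))

    round : Subset N → Point → (List Point → Dist Outcome) → Dist Outcome
    round M p K = if allTrue (M ∪ ⁅ p ⁆) then return (true , []) else (call p >>= K)

    round-cases : ∀ (P : Dist Outcome → Set) (M : Subset N) p K →
      (allTrue (M ∪ ⁅ p ⁆) ≡ true → P (return (true , []))) → (allTrue (M ∪ ⁅ p ⁆) ≡ false → P (call p >>= K)) →
      P (round M p K)
    round-cases P M p K done continue with allTrue (M ∪ ⁅ p ⁆) in eq
    ... | true  = done refl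
    ... | false = continue refl

    prefix : List Point → Dist Outcome → Dist Outcome
    prefix s d = d >>= λ x → return (proj₁ x , s ++ proj₂ x)

    SubProb-adversary : ∀ f (M : Subset N) → SubProb (adversaryFuel β k′ Q f M)
    SubProb-adversary zero    M = SubProb-return (false , [])
    SubProb-adversary (suc f) M = SubProb->>= (SubProb-uniform (allFin N)) λ p →
      round-cases SubProb M p _ (λ _ → SubProb-return (true , []))
        (λ _ → SubProb->>= (SubProb-strategy β Q k′ (∁ ⁅ p ⁆))
                 λ s → SubProb->>= (SubProb-adversary f (M ∪ ⁅ p ⁆)) λ x → SubProb-return (proj₁ x , s ++ proj₂ x))

    last : Fin (suc k′)
    last = Fin.fromℕ k′

    k′≤last : k′ ≤ℕ toℕ last
    k′≤last = ℕₚ.≤-reflexive (sym (Finₚ.toℕ-fromℕ k′))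

    -- A finished run can be served at cost calls σ · c_{k-1} once the heaviest server stands at the point h
    -- marked last: h is requested by no call, so it stays in place throughout.
    Finished : Subset N → Outcome → Set
    Finished M (b , σ) = b ≡ true → ∃ λ h → h ∉ M ×
      (∀ c → lookup c last ≡ h → ∃ λ c′ → Serve c σ c′ (calls σ ℕ.* cseq β k′))

    Finished-prefix : ∀ (M : Subset N) p {s b t} → length s ≡ L → ServedBelow k′ (∁ ⁅ p ⁆) s →
      Finished (M ∪ ⁅ p ⁆) (b , t) → Finished M (b , s ++ t)
    Finished-prefix M p {s} {b} {t} ∣s∣≡L served-s finished-t b≡true with finished-t b≡true
    ... | h , h∉M∪p , served-t = h , (λ h∈M → h∉M∪p (Subsetₚ.p⊆p∪q ⁅ p ⁆ h∈M)) , served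
      where
      h∈∁p : h ∈ ∁ ⁅ p ⁆
      h∈∁p = Subsetₚ.x∉p⇒x∈∁p (λ h∈p → h∉M∪p (Subsetₚ.q⊆p∪q M ⁅ p ⁆ h∈p))
      served : ∀ c → lookup c last ≡ h → ∃ λ c′ → Serve c (s ++ t) c′ (calls (s ++ t) ℕ.* cseq β k′)
      served c cl≡h with served-s c (last , k′≤last , subst (_∈ ∁ ⁅ p ⁆) (sym cl≡h) h∈∁p)
      ... | c₁ , agree , serve-s with served-t c₁ (trans (AgreeFrom.at agree last k′≤last) cl≡h)
      ...   | c₂ , serve-t = c₂ , subst (Serve c (s ++ t) c₂) (cong (ℕ._* cseq β k′) (sym (calls-++ s t ∣s∣≡L)))
                                        (Serve-++ serve-s serve-t)

    last-marked-unmarked : ∀ (M : Subset N) p → ¬ (∣ ∁ M ∣ ≡ 0) → allTrue (M ∪ ⁅ p ⁆) ≡ true → p ∉ M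
    last-marked-unmarked M p unmarked all-marked p∈M =
      unmarked (allTrue⇒∣∁p∣≡0 M (subst (λ M′ → allTrue M′ ≡ true) (x∈p⇒p∪⁅x⁆≡p p∈M) all-marked))

    still-unmarked : ∀ (M′ : Subset N) → allTrue M′ ≡ false → ¬ (∣ ∁ M′ ∣ ≡ 0)
    still-unmarked M′ not-all ∣∁M′∣≡0 with trans (sym (∣∁p∣≡0⇒allTrue M′ ∣∁M′∣≡0)) not-all
    ... | ()

    call-outcome : ∀ p → Surely (λ s → length s ≡ L × ServedBelow k′ (∁ ⁅ p ⁆) s) (call p)
    call-outcome p = Surely-zip (strategy-length k′ (∁ ⁅ p ⁆) (∣∁⁅p⁆∣ p)) (strategy-served k′ (∁ ⁅ p ⁆) (∣∁⁅p⁆∣ p))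

    adversary-finished : ∀ f (M : Subset N) → ¬ (∣ ∁ M ∣ ≡ 0) → Surely (Finished M) (adversaryFuel β k′ Q f M)
    adversary-finished zero    M _        = Surely-return (λ ())
    adversary-finished (suc f) M unmarked = Surely->>= (Surely-uniform (allFin N)) λ {p} _ →
      round-cases (Surely (Finished M)) M p _
        (λ all-marked → Surely-return λ _ →
           p , last-marked-unmarked M p unmarked all-marked , λ c _ → c , Serve-weaken ℕ.z≤n (Serve-[] c))
        (λ not-all → Surely->>= (call-outcome p) λ (∣s∣≡L , served-s) →
           Surely->>= (adversary-finished f (M ∪ ⁅ p ⁆) (still-unmarked (M ∪ ⁅ p ⁆) not-all)) λ {(b , t)} finished-t →
             Surely-return (Finished-prefix M p {b = b} {t} ∣s∣≡L served-s finished-t))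

    isFinished : Outcome → ℚ
    isFinished (b , σ) = if b then 1ℚ else 0ℚ

    callsIfFinished : Outcome → ℚ
    callsIfFinished (b , σ) = if b then fromℕ (calls σ) else 0ℚ

    𝔼-isFinished-≤-1 : ∀ f M → 𝔼 (adversaryFuel β k′ Q f M) isFinished ≤ 1ℚ
    𝔼-isFinished-≤-1 f M = 𝔼-≤-bound _ (SubProb-adversary f M) (ℚₚ.nonNegative⁻¹ 1ℚ)
      (Surely-map (λ { {true , _} _ → ℚₚ.≤-refl ; {false , _} _ → ℚₚ.nonNegative⁻¹ 1ℚ }) (proj₁ (SubProb-adversary f M)))

    𝔼-callsIfFinished-prefix : ∀ s d → length s ≡ L →
      𝔼 (prefix s d) callsIfFinished ≡ 𝔼 d isFinished + 𝔼 d callsIfFinished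
    𝔼-callsIfFinished-prefix s d ∣s∣≡L = begin
      𝔼 (prefix s d) callsIfFinished
        ≡⟨ 𝔼->>= d (λ x → return (proj₁ x , s ++ proj₂ x)) callsIfFinished ⟩
      𝔼 d (λ x → 𝔼 (return (proj₁ x , s ++ proj₂ x)) callsIfFinished) ≡⟨ 𝔼-cong d one-more-call ⟩
      𝔼 d (λ x → isFinished x + callsIfFinished x)                     ≡⟨ 𝔼-+ d isFinished callsIfFinished ⟩
      𝔼 d isFinished + 𝔼 d callsIfFinished                             ∎
      where
      open ≡-Reasoning
      one-more-call : ∀ x → 𝔼 (return (proj₁ x , s ++ proj₂ x)) callsIfFinished ≡ isFinished x + callsIfFinished x
      one-more-call (true , t)  = trans (𝔼-return (true , s ++ t) callsIfFinished)
                                        (trans (cong fromℕ (calls-++ s t ∣s∣≡L)) (sym (fromℕ-+ 1 (calls t))))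
      one-more-call (false , t) = 𝔼-return (false , s ++ t) callsIfFinished

    CallsBound : ℕ → Set
    CallsBound f = ∀ (M : Subset N) v → ∣ ∁ M ∣ ≡ suc v →
                   𝔼 (adversaryFuel β k′ Q f M) callsIfFinished ≤ fromℕ N * H (suc v) - 1ℚ

    𝔼-call-then-continue : ∀ f → CallsBound f → ∀ (M′ : Subset N) p v → ∣ ∁ M′ ∣ ≡ suc v →
      𝔼 (call p >>= λ s → prefix s (adversaryFuel β k′ Q f M′)) callsIfFinished ≤ fromℕ N * H (suc v)
    𝔼-call-then-continue f bound M′ p v ∣∁M′∣≡1+v = begin
      𝔼 (call p >>= λ s → prefix s d) callsIfFinished   ≡⟨ 𝔼->>= (call p) (λ s → prefix s d) callsIfFinished ⟩
      𝔼 (call p) (λ s → 𝔼 (prefix s d) callsIfFinished) ≤⟨ 𝔼-≤-bound (call p) (SubProb-strategy β Q k′ (∁ ⁅ p ⁆))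
                                                             (0≤* (0≤fromℕ N) (0≤H (suc v)))
                                                             (Surely-map one-call (strategy-length k′ (∁ ⁅ p ⁆) (∣∁⁅p⁆∣ p))) ⟩
      fromℕ N * H (suc v)                                ∎
      where
      open ℚₚ.≤-Reasoning
      d = adversaryFuel β k′ Q f M′
      one-call : ∀ {s} → length s ≡ L → 𝔼 (prefix s d) callsIfFinished ≤ fromℕ N * H (suc v)
      one-call {s} ∣s∣≡L = begin
        𝔼 (prefix s d) callsIfFinished                   ≡⟨ 𝔼-callsIfFinished-prefix s d ∣s∣≡L ⟩
        𝔼 d isFinished + 𝔼 d callsIfFinished             ≤⟨ ℚₚ.+-mono-≤ (𝔼-isFinished-≤-1 f M′) (bound M′ v ∣∁M′∣≡1+v) ⟩
        1ℚ + (fromℕ N * H (suc v) - 1ℚ)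
          ≡⟨ solve 2 (λ x one → one :+ (x :- one) := x) refl (fromℕ N * H (suc v)) 1ℚ ⟩
        fromℕ N * H (suc v)                              ∎

    𝔼-round : ∀ f → CallsBound f → ∀ (M : Subset N) p →
      𝔼 (round M p (λ s → prefix s (adversaryFuel β k′ Q f (M ∪ ⁅ p ⁆)))) callsIfFinished ≤ fromℕ N * H ∣ ∁ (M ∪ ⁅ p ⁆) ∣
    𝔼-round f bound M p = round-cases (λ d → 𝔼 d callsIfFinished ≤ fromℕ N * H ∣ ∁ (M ∪ ⁅ p ⁆) ∣) M p _
      (λ _ → ℚₚ.≤-trans (ℚₚ.≤-reflexive (trans (𝔼-return (true , []) callsIfFinished) (cong fromℕ calls-[])))
                        (0≤* (0≤fromℕ N) (0≤H ∣ ∁ (M ∪ ⁅ p ⁆) ∣)))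
      (λ not-all → continue _ refl not-all)
      where
      continue : ∀ u → ∣ ∁ (M ∪ ⁅ p ⁆) ∣ ≡ u → allTrue (M ∪ ⁅ p ⁆) ≡ false →
        𝔼 (call p >>= λ s → prefix s (adversaryFuel β k′ Q f (M ∪ ⁅ p ⁆))) callsIfFinished ≤ fromℕ N * H u
      continue zero    ∣∁M′∣≡0   not-all = ⊥-elim (still-unmarked (M ∪ ⁅ p ⁆) not-all ∣∁M′∣≡0)
      continue (suc v) ∣∁M′∣≡1+v _       = 𝔼-call-then-continue f bound (M ∪ ⁅ p ⁆) p v ∣∁M′∣≡1+v

    𝔼-callsIfFinished-≤ : ∀ f → CallsBound f
    𝔼-callsIfFinished-≤ zero    M v _ = begin
      𝔼 (return (false , [])) callsIfFinished ≡⟨ 𝔼-return (false , []) callsIfFinished ⟩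
      0ℚ                                      ≡⟨ ℚₚ.+-inverseʳ 1ℚ ⟨
      1ℚ - 1ℚ                                 ≤⟨ ℚₚ.+-monoˡ-≤ (ℚ.- 1ℚ) (1≤fromℕ-suc*H-suc (nseq k′) v) ⟩
      fromℕ N * H (suc v) - 1ℚ                ∎
      where open ℚₚ.≤-Reasoning
    𝔼-callsIfFinished-≤ (suc f) M v ∣∁M∣≡1+v = begin
      𝔼 (adversaryFuel β k′ Q (suc f) M) callsIfFinished
        ≡⟨ 𝔼->>= (uniform (allFin N)) (λ p → round M p (K p)) callsIfFinished ⟩
      𝔼 (uniform (allFin N)) roundValue                           ≡⟨ 𝔼-uniform-allFin (nseq k′) roundValue ⟩
      w * ∑ roundValue                                             ≤⟨ *-mono-≤-nonNegˡ (0≤1/suc (nseq k′))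
                                                                        (∑-≤-split M roundValue marked unmarked) ⟩
      w * (fromℕ ∣ M ∣ * (fromℕ N * H (suc v)) + fromℕ ∣ ∁ M ∣ * (fromℕ N * H v))
        ≡⟨ cong (λ u → w * (fromℕ ∣ M ∣ * (fromℕ N * H (suc v)) + fromℕ u * (fromℕ N * H v))) ∣∁M∣≡1+v ⟩
      w * (fromℕ ∣ M ∣ * (fromℕ N * H (suc v)) + fromℕ (suc v) * (fromℕ N * H v))
        ≡⟨ coupon-step (nseq k′) ∣ M ∣ v (trans (cong (∣ M ∣ ℕ.+_) (sym ∣∁M∣≡1+v)) (∣p∣+∣∁p∣≡n M)) ⟩
      fromℕ N * H (suc v) - 1ℚ                                     ∎
      where
      open ℚₚ.≤-Reasoning
      w = ℤ.+ 1 ℚ./ N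
      K : Point → List Point → Dist Outcome
      K p s = prefix s (adversaryFuel β k′ Q f (M ∪ ⁅ p ⁆))
      roundValue : Point → ℚ
      roundValue p = 𝔼 (round M p (K p)) callsIfFinished
      roundValue-≤ : ∀ p → roundValue p ≤ fromℕ N * H ∣ ∁ (M ∪ ⁅ p ⁆) ∣
      roundValue-≤ = 𝔼-round f (𝔼-callsIfFinished-≤ f) M
      marked : ∀ {p} → p ∈ M → roundValue p ≤ fromℕ N * H (suc v)
      marked {p} p∈M = subst (λ u → roundValue p ≤ fromℕ N * H u)
        (trans (cong (λ M′ → ∣ ∁ M′ ∣) (x∈p⇒p∪⁅x⁆≡p p∈M)) ∣∁M∣≡1+v) (roundValue-≤ p)
      unmarked : ∀ {p} → p ∉ M → roundValue p ≤ fromℕ N * H v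
      unmarked {p} p∉M = subst (λ u → roundValue p ≤ fromℕ N * H u)
        (ℕₚ.suc-injective (trans (sym (x∉p⇒∣∁p∣≡1+∣∁p∪⁅x⁆∣ M p∉M)) ∣∁M∣≡1+v)) (roundValue-≤ p)

    opt-≤-Finished : ∀ c {σ} → Finished Subset.⊥ (true , σ) → opt β c σ ≤ℕ β ^ k′ ℕ.+ calls σ ℕ.* cseq β k′
    opt-≤-Finished c {σ} finished with finished refl
    ... | h , _ , served with served (c [ last ]≔ h) (Vecₚ.lookup∘update last c h)
    ...   | _ , serve-σ = ℕₚ.≤-trans (opt-≤-move σ c (c [ last ]≔ h)) (ℕₚ.+-mono-≤ move (opt-≤-Serve serve-σ))
      where
      move : moveCost β c (c [ last ]≔ h) ≤ℕ β ^ k′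
      move = subst (λ n → moveCost β c (c [ last ]≔ h) ≤ℕ β ^ n) (Finₚ.toℕ-fromℕ k′) (moveCost-update c last h)

    module _ (c : Config) where

      optIfFinished : Outcome → ℚ
      optIfFinished (b , σ) = if b then fromℕ (opt β c σ) else 0ℚ

      expectedOptFuel≡𝔼 : ∀ fuel → expectedOptFuel β k′ Q c fuel ≡ 𝔼 (adversaryFuel β k′ Q fuel Subset.⊥) optIfFinished
      expectedOptFuel≡𝔼 fuel = go (adversaryFuel β k′ Q fuel Subset.⊥)
        where
        go : ∀ d → List.foldr (λ x acc → (if proj₁ (proj₂ x) then proj₁ x * fromℕ (opt β c (proj₂ (proj₂ x))) else 0ℚ) + acc) 0ℚ d
                   ≡ 𝔼 d optIfFinished
        go []                      = refl
        go ((p , (true  , σ)) ∷ d) = cong (p * fromℕ (opt β c σ) +_) (go d)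
        go ((p , (false , σ)) ∷ d) = cong₂ _+_ (sym (ℚₚ.*-zeroʳ p)) (go d)

      private
        B = fromℕ (β ^ k′)
        C = fromℕ (cseq β k′)

      optIfFinished-≤ : ∀ {x} → Finished Subset.⊥ x → optIfFinished x ≤ B * isFinished x + C * callsIfFinished x
      optIfFinished-≤ {true , σ} finished = begin
        fromℕ (opt β c σ)                              ≤⟨ fromℕ-mono-≤ (opt-≤-Finished c finished) ⟩
        fromℕ (β ^ k′ ℕ.+ calls σ ℕ.* cseq β k′)       ≡⟨ fromℕ-+ (β ^ k′) _ ⟨
        B + fromℕ (calls σ ℕ.* cseq β k′)               ≡⟨ cong (B +_) (fromℕ-* (calls σ) (cseq β k′)) ⟨
        B + fromℕ (calls σ) * C
          ≡⟨ solve 3 (λ b x y → b :+ x :* y := b :* con 1ℚ :+ y :* x) refl B (fromℕ (calls σ)) C ⟩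
        B * 1ℚ + C * fromℕ (calls σ)                    ∎
        where open ℚₚ.≤-Reasoning
      optIfFinished-≤ {false , σ} _ = ℚₚ.≤-reflexive (solve 2 (λ b y → con 0ℚ := b :* con 0ℚ :+ y :* con 0ℚ) refl B C)

      expectedOptFuel-≤ : ∀ fuel → expectedOptFuel β k′ Q c fuel ≤ B + (fromℕ N * H N - 1ℚ) * C
      expectedOptFuel-≤ fuel = begin
        expectedOptFuel β k′ Q c fuel                         ≡⟨ expectedOptFuel≡𝔼 fuel ⟩
        𝔼 d optIfFinished
          ≤⟨ 𝔼-mono d (Surely-map optIfFinished-≤ (adversary-finished fuel Subset.⊥ ⊥-unmarked)) ⟩
        𝔼 d (λ x → B * isFinished x + C * callsIfFinished x)  ≡⟨ 𝔼-+ d _ _ ⟩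
        𝔼 d (λ x → B * isFinished x) + 𝔼 d (λ x → C * callsIfFinished x)
          ≡⟨ cong₂ _+_ (𝔼-* d B isFinished) (𝔼-* d C callsIfFinished) ⟩
        B * 𝔼 d isFinished + C * 𝔼 d callsIfFinished
          ≤⟨ ℚₚ.+-mono-≤ (*-mono-≤-nonNegˡ (0≤fromℕ (β ^ k′)) (𝔼-isFinished-≤-1 fuel Subset.⊥))
                         (*-mono-≤-nonNegˡ (0≤fromℕ (cseq β k′)) (𝔼-callsIfFinished-≤ fuel Subset.⊥ (nseq k′) (∣∁⊥∣≡n N))) ⟩
        B * 1ℚ + C * (fromℕ N * H N - 1ℚ)
          ≡⟨ solve 3 (λ b y x → b :* con 1ℚ :+ y :* x := b :+ x :* y) refl B C (fromℕ N * H N - 1ℚ) ⟩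
        B + (fromℕ N * H N - 1ℚ) * C                           ∎
        where
        open ℚₚ.≤-Reasoning
        d = adversaryFuel β k′ Q fuel Subset.⊥
        ⊥-unmarked : ¬ (∣ ∁ (Subset.⊥ {N}) ∣ ≡ 0)
        ⊥-unmarked ∣∁⊥∣≡0 = ℕₚ.1+n≢0 (trans (sym (∣∁⊥∣≡n N)) ∣∁⊥∣≡0)

open import Data.Nat using (ℕ; suc; _+_; _*_; _^_; _≥_; ⌈_/2⌉)
open import Data.Fin using (Fin)
open import Data.Fin.Subset using (Subset; _∈_; _∉_; _⊆_; ∣_∣)
open import Data.List using (List; length)
open import Data.List.Relation.Unary.All using (All)
open import Data.List.Relation.Unary.Any using (Any)
open import Data.List.Relation.Unary.Unique.Propositional using (Unique)
open import Data.Vec using (Vec)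
open import Data.Product using (_×_; ∃)
open import Data.Sum using (_⊎_)
open import Data.Rational using (_≤_; _-_; 1ℚ)
open import Relation.Binary.PropositionalEquality using (_≡_)

lemma5 : (β : ℕ) → β ≥ 1 → (k' : ℕ) →
    (Q : SetSystem (suc (nseq k'))) →
    (∀ l (Y : Subset (suc (nseq k'))) → ∣ Y ∣ ≡ nseq (suc l) →
      (length (Q (suc l) Y) ≡ ⌈ nseq l /2⌉ + 1)
      × Unique (Q (suc l) Y)
      × All (λ S → S ⊆ Y × ∣ S ∣ ≡ nseq l) (Q (suc l) Y)
      × (∀ p → p ∈ Y → Any (λ S → p ∉ S) (Q (suc l) Y))
      × (∀ p → p ∈ Y → ∃ λ q → q ∈ Y × All (λ S → p ∈ S ⊎ q ∈ S) (Q (suc l) Y))) →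
    (c : Vec (Fin (suc (nseq k'))) (suc k')) →
    (fuel : ℕ) →
    expectedOptFuel β k' Q c fuel ≤
      fromℕ (β ^ k') Data.Rational.+
        ((fromℕ (nseq k' + 1) Data.Rational.* H (nseq k' + 1) - 1ℚ) Data.Rational.* fromℕ (cseq β k'))
lemma5 β 1≤β k' Q 𝒬-conditions c fuel rewrite ℕₚ.+-comm (nseq k') 1 =
  Adversary.expectedOptFuel-≤ β 1≤β k' Q admissible c fuel
  where
  admissible : Admissible Q
  admissible = record
    { sizes   = λ l Y ∣Y∣ → All.map proj₂ (proj₁ (proj₂ (proj₂ (𝒬-conditions l Y ∣Y∣))))
    ; partner = λ l Y ∣Y∣ p p∈Y → let q , _ , covered = proj₂ (proj₂ (proj₂ (proj₂ (𝒬-conditions l Y ∣Y∣)))) p p∈Y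
                                 in q , covered
    }
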